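{- For every $n\ge 3$, $\chi'_{qm\Sigma}(K_n)=3$.
   Context: A $k$-edge-coloring of a graph $G$ is any map $c:E(G)\to[k]$ (adjacent edges may receive the same color). It induces $\sigma_c(v)=\sum_{u\in N(v)}c(vu)$. The coloring is neighbor sum distinguishing (NSD) if $\sigma_c(u)\ne\sigma_c(v)$ for every edge $uv$, and quasi-majority (QM) if every vertex $v$ is incident to at most $\lceil d(v)/2\rceil$ edges of each color. $\chi'_{qm\Sigma}(G)$ is the minimum $k$ such that $G$ has a QM and NSD $k$-edge-coloring. -}

module Defs where

open import Data.Nat using (ℕ; zero; suc; _+_; _≤_; _<_; _∸_)
open import Data.Nat.Base using (⌊_/2⌋)
open import Data.Fin using (Fin; toℕ)
open import Data.Fin.Properties using (_≟_)
open import Data.List using (List; map; filter; length)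
open import Data.Nat.ListAction using (sum)
open import Data.List.Base using (allFin)
open import Data.Product using (Σ; _×_)
open import Relation.Nullary using (¬_)
open import Relation.Nullary.Decidable using (¬?)
open import Relation.Binary.PropositionalEquality using (_≡_; _≢_)

-- The complete graph K_n has vertex set Fin n; uv is an edge iff u ≢ v.
-- A k-edge-coloring of K_n: a map c assigning to each ordered pair a color in
-- Fin k (color i ∈ Fin k stands for the integer i+1 ∈ [k]); it must be
-- symmetric on edges so that it is a function of the unordered edge uv.
-- Values on the diagonal (non-edges) are irrelevant.
EdgeColoring : ℕ → ℕ → Set
EdgeColoring n k = Fin n → Fin n → Fin k

Symmetric : ∀ {n k} → EdgeColoring n k → Set
Symmetric {n} c = ∀ (u v : Fin n) → u ≢ v → c u v ≡ c v u

colVal : ∀ {k} → Fin k → ℕ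
colVal i = suc (toℕ i)

nbrs : ∀ {n} → Fin n → List (Fin n)
nbrs v = filter (λ u → ¬? (u ≟ v)) (allFin _)

σ : ∀ {n k} → EdgeColoring n k → Fin n → ℕ
σ c v = sum (map (λ u → colVal (c v u)) (nbrs v))

deg : ∀ {n} → Fin n → ℕ
deg v = length (nbrs v)

⌈_/2⌉ : ℕ → ℕ
⌈ d /2⌉ = ⌊ suc d /2⌋

colorCount : ∀ {n k} → EdgeColoring n k → Fin n → Fin k → ℕ
colorCount c v a = length (filter (λ u → c v u ≟ a) (nbrs v))

NSD : ∀ {n k} → EdgeColoring n k → Set
NSD {n} c = ∀ (u v : Fin n) → u ≢ v → σ c u ≢ σ c v

QM : ∀ {n k} → EdgeColoring n k → Set
QM {n} {k} c = ∀ (v : Fin n) (a : Fin k) → colorCount c v a ≤ ⌈ deg v /2⌉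

HasQMNSD : ℕ → ℕ → Set
HasQMNSD n k = Σ (EdgeColoring n k) (λ c → Symmetric c × QM c × NSD c)

χqmΣ-K≡ : ℕ → ℕ → Set
χqmΣ-K≡ n m = HasQMNSD n m × (∀ k → k < m → ¬ HasQMNSD n k)

module Submission where

-- Two colors never suffice: at a vertex of K_n of degree d, colors 1 and 2 give σ = d + t, where t
-- is the number of edges of color 2, and quasi-majority pins t to ⌊d/2⌋ or ⌈d/2⌉ = ⌊d/2⌋ + 1; so
-- three vertices of a triangle cannot have pairwise distinct sums.
--
-- In K_{2m+1} group the vertices into the pairs {2a, 2a+1} (with 2m alone)
-- and color each edge by the parity of the distance between the pairs of its ends. Every lower
-- pair contributes 4 to the sum of a vertex, while the higher pairs alternately contribute 6 and 4
-- at the first vertex of a pair and 2 and 4 at the second (the lone vertex counting half), so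
-- σ v = 3m + rank v for a bijection rank onto {0, …, 2m}. For K_{2m+2} add a hub whose edge to v
-- has a color non-decreasing in rank v: the sums of the old vertices stay strictly increasing in
-- rank and skip exactly the hub's sum 4m + 3.

open import Defs
open import Algebra.Properties.CommutativeSemigroup using (interchange)
open import Data.Bool using (Bool; true; false; if_then_else_; not)
open import Data.Bool.Properties using (if-float)
open import Data.Empty using (⊥; ⊥-elim)
open import Data.Fin using (Fin; zero; suc; toℕ)
open import Data.Fin.Properties using (_≟_)
open import Data.List using (List; []; _∷_; map; filter; length; allFin)
open import Data.List.Properties using (map-∘; map-tabulate; map-cong; length-map; length-tabulate)
open import Data.Nat using (ℕ; zero; suc; _+_; _*_; _≤_; _<_; _≥_; z≤n; s≤s; ⌊_/2⌋)
open import Data.Nat.ListAction using (sum)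
open import Data.Nat.Properties
  using (≤-refl; ≤-reflexive; ≤-trans; ≤-antisym; <⇒≤; <⇒≢; >⇒≢; ≰⇒>; <-cmp; _≤?_; n<1+n; n≤1+n;
         m≤n⇒m≤1+n; m≤n⇒m<n∨m≡n; m≤m+n; suc-injective; +-comm; +-assoc; +-identityʳ; +-cancelˡ-≡;
         +-cancelˡ-≤; +-mono-≤; +-monoˡ-≤; +-monoʳ-<; +-mono-<-≤; *-suc; *-identityʳ; *-monoʳ-≤;
         ⌊n/2⌋-mono; ⌊n/2⌋+⌈n/2⌉≡n; +-commutativeSemigroup; module ≤-Reasoning)
open import Data.Nat.Tactic.RingSolver using (solve-∀; solve)
open import Data.Product using (_,_; ∃)
open import Data.Sum using (_⊎_; inj₁; inj₂)
open import Function using (_∘_; id)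
open import Relation.Binary.Definitions using (tri<; tri≈; tri>)
open import Relation.Binary.PropositionalEquality
  using (_≡_; _≢_; refl; sym; trans; cong; cong₂; subst; module ≡-Reasoning)
open import Relation.Nullary using (¬_; Dec; does; yes; no)
open import Relation.Nullary.Decidable using (¬?)

-- Sums over neighbourhoods

sum-map-+ : ∀ {A : Set} (f g : A → ℕ) xs →
            sum (map (λ x → f x + g x) xs) ≡ sum (map f xs) + sum (map g xs)
sum-map-+ f g [] = refl
sum-map-+ f g (x ∷ xs) =
  trans (cong (f x + g x +_) (sum-map-+ f g xs)) (interchange +-commutativeSemigroup (f x) (g x) _ _)

sum-map-const : ∀ {A : Set} (xs : List A) → sum (map (λ _ → 1) xs) ≡ length xs
sum-map-const [] = refl
sum-map-const (x ∷ xs) = cong suc (sum-map-const xs)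

length-filter≡sum : ∀ {A : Set} {P : A → Set} (P? : ∀ x → Dec (P x)) xs →
                    length (filter P? xs) ≡ sum (map (λ x → if does (P? x) then 1 else 0) xs)
length-filter≡sum P? [] = refl
length-filter≡sum P? (x ∷ xs) with does (P? x)
... | true  = cong suc (length-filter≡sum P? xs)
... | false = length-filter≡sum P? xs

allFin-suc : ∀ n → allFin (suc n) ≡ zero ∷ map suc (allFin n)
allFin-suc n = cong (zero ∷_) (sym (map-tabulate id suc))

filter-≢zero-map-suc : ∀ {n} (xs : List (Fin n)) →
                       filter (λ u → ¬? (u ≟ zero)) (map suc xs) ≡ map suc xs
filter-≢zero-map-suc [] = refl
filter-≢zero-map-suc (x ∷ xs) = cong (suc x ∷_) (filter-≢zero-map-suc xs)

filter-≢suc-map-suc : ∀ {n} (w : Fin n) xs →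
  filter (λ u → ¬? (u ≟ suc w)) (map suc xs) ≡ map suc (filter (λ u → ¬? (u ≟ w)) xs)
filter-≢suc-map-suc w [] = refl
filter-≢suc-map-suc w (x ∷ xs) with x ≟ w
... | yes _ = filter-≢suc-map-suc w xs
... | no _  = cong (suc x ∷_) (filter-≢suc-map-suc w xs)

nbrs-zero : ∀ n → nbrs {suc n} zero ≡ map suc (allFin n)
nbrs-zero n =
  trans (cong (filter (λ u → ¬? (u ≟ zero))) (allFin-suc n)) (filter-≢zero-map-suc (allFin n))

nbrs-suc : ∀ {n} (w : Fin n) → nbrs (suc w) ≡ zero ∷ map suc (nbrs w)
nbrs-suc {n} w = trans (cong (filter (λ u → ¬? (u ≟ suc w))) (allFin-suc n))
                       (cong (zero ∷_) (filter-≢suc-map-suc w (allFin n)))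

deg-complete : ∀ {n} (v : Fin (suc n)) → deg v ≡ n
deg-complete {n} zero =
  trans (cong length (nbrs-zero n)) (trans (length-map suc (allFin n)) (length-tabulate id))
deg-complete {suc n} (suc w) =
  trans (cong length (nbrs-suc w)) (cong suc (trans (length-map suc (nbrs w)) (deg-complete w)))

sumFin : ∀ n → (Fin n → ℕ) → ℕ
sumFin n h = sum (map h (allFin n))

nbrSum : ∀ {n} → Fin n → (Fin n → ℕ) → ℕ
nbrSum v h = sum (map h (nbrs v))

sum-map-suc : ∀ {n} (h : Fin (suc n) → ℕ) xs → sum (map h (map suc xs)) ≡ sum (map (h ∘ suc) xs)
sum-map-suc h xs = cong sum (sym (map-∘ xs))

sumFin-suc : ∀ n (h : Fin (suc n) → ℕ) → sumFin (suc n) h ≡ h zero + sumFin n (h ∘ suc)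
sumFin-suc n h =
  trans (cong (sum ∘ map h) (allFin-suc n)) (cong (h zero +_) (sum-map-suc h (allFin n)))

sumFin-cong : ∀ n {f g : Fin n → ℕ} → (∀ x → f x ≡ g x) → sumFin n f ≡ sumFin n g
sumFin-cong n f≗g = cong sum (map-cong f≗g (allFin n))

nbrSum-zero : ∀ n (h : Fin (suc n) → ℕ) → nbrSum zero h ≡ sumFin n (h ∘ suc)
nbrSum-zero n h = trans (cong (sum ∘ map h) (nbrs-zero n)) (sum-map-suc h (allFin n))

nbrSum-suc : ∀ {n} (w : Fin n) (h : Fin (suc n) → ℕ) → nbrSum (suc w) h ≡ h zero + nbrSum w (h ∘ suc)
nbrSum-suc w h =
  trans (cong (sum ∘ map h) (nbrs-suc w)) (cong (h zero +_) (sum-map-suc h (nbrs w)))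

-- σ c is definitionally colorSum c colVal.
colorSum : ∀ {n k} → EdgeColoring n k → (Fin k → ℕ) → Fin n → ℕ
colorSum c G v = nbrSum v (λ u → G (c v u))

indicator : ∀ {k} → Fin k → Fin k → ℕ
indicator a x = if does (x ≟ a) then 1 else 0

colorSum-+ : ∀ {n k} (c : EdgeColoring n k) F G v →
             colorSum c (λ x → F x + G x) v ≡ colorSum c F v + colorSum c G v
colorSum-+ c F G v = sum-map-+ (λ u → F (c v u)) (λ u → G (c v u)) (nbrs v)

colorSum-cong : ∀ {n k} (c : EdgeColoring n k) {F G : Fin k → ℕ} → (∀ x → F x ≡ G x) →
                ∀ v → colorSum c F v ≡ colorSum c G v
colorSum-cong c F≗G v = cong sum (map-cong (λ u → F≗G (c v u)) (nbrs v))

colorCount≡colorSum : ∀ {n k} (c : EdgeColoring n k) v a → colorCount c v a ≡ colorSum c (indicator a) v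
colorCount≡colorSum c v a = length-filter≡sum (λ u → c v u ≟ a) (nbrs v)

deg≡colorSum : ∀ {n k} (c : EdgeColoring n k) v → deg v ≡ colorSum c (λ _ → 1) v
deg≡colorSum c v = sym (sum-map-const (nbrs v))

indicator≤1 : ∀ {k} (a x : Fin k) → indicator a x ≤ 1
indicator≤1 a x with x ≟ a
... | yes _ = ≤-refl
... | no _  = z≤n

indicator-distinct : ∀ {k} (a : Fin k) {x y} → x ≢ y → indicator a x + indicator a y ≤ 1
indicator-distinct a {x} {y} x≢y with x ≟ a | y ≟ a
... | yes refl | yes refl = ⊥-elim (x≢y refl)
... | yes _    | no _     = ≤-refl
... | no _     | yes _    = ≤-refl
... | no _     | no _     = z≤n

-- Lower bound

σ-one-color : ∀ {n} (c : EdgeColoring n 1) v → σ c v ≡ deg v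
σ-one-color c v = trans (colorSum-cong c {colVal} {λ _ → 1} (λ { zero → refl }) v) (sym (deg≡colorSum c v))

σ-two-colors : ∀ {n} (c : EdgeColoring n 2) v → σ c v ≡ deg v + colorCount c v (suc zero)
σ-two-colors c v = begin
  colorSum c colVal v                                           ≡⟨ colorSum-cong c colVal≡1+indicator v ⟩
  colorSum c (λ x → 1 + indicator (suc zero) x) v               ≡⟨ colorSum-+ c (λ _ → 1) (indicator (suc zero)) v ⟩
  colorSum c (λ _ → 1) v + colorSum c (indicator (suc zero)) v  ≡˘⟨ cong₂ _+_ (deg≡colorSum c v) (colorCount≡colorSum c v (suc zero)) ⟩
  deg v + colorCount c v (suc zero)                             ∎
  where
  open ≡-Reasoning
  colVal≡1+indicator : ∀ x → colVal x ≡ 1 + indicator (suc zero) x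
  colVal≡1+indicator zero = refl
  colVal≡1+indicator (suc zero) = refl

colorCount-two-colors : ∀ {n} (c : EdgeColoring n 2) v →
                        colorCount c v zero + colorCount c v (suc zero) ≡ deg v
colorCount-two-colors c v = begin
  colorCount c v zero + colorCount c v (suc zero)                     ≡⟨ cong₂ _+_ (colorCount≡colorSum c v zero) (colorCount≡colorSum c v (suc zero)) ⟩
  colorSum c (indicator zero) v + colorSum c (indicator (suc zero)) v ≡˘⟨ colorSum-+ c (indicator zero) (indicator (suc zero)) v ⟩
  colorSum c (λ x → indicator zero x + indicator (suc zero) x) v      ≡⟨ colorSum-cong c indicators-sum v ⟩
  colorSum c (λ _ → 1) v                                              ≡˘⟨ deg≡colorSum c v ⟩
  deg v                                                               ∎
  where
  open ≡-Reasoning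
  indicators-sum : ∀ x → indicator zero x + indicator (suc zero) x ≡ 1
  indicators-sum zero = refl
  indicators-sum (suc zero) = refl

balanced-split : ∀ {d a t} → a + t ≡ d → a ≤ ⌈ d /2⌉ → t ≤ ⌈ d /2⌉ → t ≡ ⌊ d /2⌋ ⊎ t ≡ suc ⌊ d /2⌋
balanced-split {d} {a} {t} a+t≡d a≤ t≤ with m≤n⇒m<n∨m≡n (≤-trans t≤ (⌊n/2⌋-mono (n≤1+n (suc d))))
... | inj₁ (s≤s t≤⌊d/2⌋) = inj₁ (≤-antisym t≤⌊d/2⌋ ⌊d/2⌋≤t)
  where
  ⌊d/2⌋≤t : ⌊ d /2⌋ ≤ t
  ⌊d/2⌋≤t = +-cancelˡ-≤ ⌈ d /2⌉ ⌊ d /2⌋ t (begin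
    ⌈ d /2⌉ + ⌊ d /2⌋ ≡⟨ +-comm ⌈ d /2⌉ ⌊ d /2⌋ ⟩
    ⌊ d /2⌋ + ⌈ d /2⌉ ≡⟨ ⌊n/2⌋+⌈n/2⌉≡n d ⟩
    d                 ≡˘⟨ a+t≡d ⟩
    a + t             ≤⟨ +-monoˡ-≤ t a≤ ⟩
    ⌈ d /2⌉ + t       ∎)
    where open ≤-Reasoning
... | inj₂ t≡1+⌊d/2⌋ = inj₂ t≡1+⌊d/2⌋

no-three-distinct : ∀ {A : Set} {a b x y z : A} → x ≡ a ⊎ x ≡ b → y ≡ a ⊎ y ≡ b → z ≡ a ⊎ z ≡ b →
                    x ≢ y → x ≢ z → y ≢ z → ⊥
no-three-distinct (inj₁ refl) (inj₁ refl) _           x≢y _   _   = x≢y refl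
no-three-distinct (inj₂ refl) (inj₂ refl) _           x≢y _   _   = x≢y refl
no-three-distinct (inj₁ refl) (inj₂ refl) (inj₁ refl) _   x≢z _   = x≢z refl
no-three-distinct (inj₁ refl) (inj₂ refl) (inj₂ refl) _   _   y≢z = y≢z refl
no-three-distinct (inj₂ refl) (inj₁ refl) (inj₁ refl) _   _   y≢z = y≢z refl
no-three-distinct (inj₂ refl) (inj₁ refl) (inj₂ refl) _   x≢z _   = x≢z refl

two-colors-insufficient : ∀ n → ¬ HasQMNSD (3 + n) 2
two-colors-insufficient n (c , _ , qm , nsd) =
  no-three-distinct (split v₀) (split v₁) (split v₂)
    (distinct v₀ v₁ (λ ())) (distinct v₀ v₂ (λ ())) (distinct v₁ v₂ (λ ()))
  where
  d = 2 + n
  v₀ v₁ v₂ : Fin (3 + n)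
  v₀ = zero
  v₁ = suc zero
  v₂ = suc (suc zero)
  t : Fin (3 + n) → ℕ
  t v = colorCount c v (suc zero)
  bounded : ∀ v a → colorCount c v a ≤ ⌈ d /2⌉
  bounded v a = subst (λ e → colorCount c v a ≤ ⌈ e /2⌉) (deg-complete v) (qm v a)
  split : ∀ v → t v ≡ ⌊ d /2⌋ ⊎ t v ≡ suc ⌊ d /2⌋
  split v = balanced-split (trans (colorCount-two-colors c v) (deg-complete v)) (bounded v zero) (bounded v (suc zero))
  distinct : ∀ u v → u ≢ v → t u ≢ t v
  distinct u v u≢v tu≡tv = nsd u v u≢v (begin
    σ c u       ≡⟨ σ-two-colors c u ⟩
    deg u + t u ≡⟨ cong₂ _+_ (trans (deg-complete u) (sym (deg-complete v))) tu≡tv ⟩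
    deg v + t v ≡˘⟨ σ-two-colors c v ⟩
    σ c v       ∎)
    where open ≡-Reasoning

fewer-colors-insufficient : ∀ n k → k < 3 → ¬ HasQMNSD (3 + n) k
fewer-colors-insufficient n 0 _ (c , _) with c zero zero
... | ()
fewer-colors-insufficient n 1 _ (c , _ , _ , nsd) =
  nsd zero (suc zero) (λ ()) (trans (σ≡2+n zero) (sym (σ≡2+n (suc zero))))
  where
  σ≡2+n : ∀ v → σ c v ≡ 2 + n
  σ≡2+n v = trans (σ-one-color c v) (deg-complete v)
fewer-colors-insufficient n 2 _ = two-colors-insufficient n
fewer-colors-insufficient n (suc (suc (suc k))) (s≤s (s≤s (s≤s ())))

-- Odd complete graphs

twice : ℕ → ℕ
twice zero = zero
twice (suc m) = suc (suc (twice m))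

odd : ℕ → ℕ
odd m = suc (twice m)

parity : ∀ n → (∃ λ m → n ≡ twice m) ⊎ (∃ λ m → n ≡ odd m)
parity zero = inj₁ (zero , refl)
parity (suc n) with parity n
... | inj₁ (m , refl) = inj₂ (m , refl)
... | inj₂ (m , refl) = inj₁ (suc m , refl)

⌈twice/2⌉ : ∀ m → ⌈ twice m /2⌉ ≡ m
⌈twice/2⌉ zero = refl
⌈twice/2⌉ (suc m) = cong suc (⌈twice/2⌉ m)

⌈odd/2⌉ : ∀ m → ⌈ odd m /2⌉ ≡ suc m
⌈odd/2⌉ zero = refl
⌈odd/2⌉ (suc m) = cong suc (⌈odd/2⌉ m)

c₁ c₂ c₃ : Fin 3
c₁ = zero
c₂ = suc zero
c₃ = suc (suc zero)

-- evenBlock j holds iff ⌊ j / 2 ⌋ is even, i.e. iff vertex 2 + j lies in a pair at odd distance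
-- from the pair {0, 1}.
evenBlock : ℕ → Bool
evenBlock zero = true
evenBlock (suc zero) = true
evenBlock (suc (suc j)) = not (evenBlock j)

-- An edge between pairs at odd distance gets color 3 at the first and 1 at the second vertex of
-- the lower pair; every other edge gets color 2.
pairColoring : ℕ → ℕ → Fin 3
pairColoring zero zero = c₂
pairColoring zero (suc zero) = c₂
pairColoring zero (suc (suc j)) = if evenBlock j then c₃ else c₂
pairColoring (suc zero) zero = c₂
pairColoring (suc zero) (suc zero) = c₂
pairColoring (suc zero) (suc (suc j)) = if evenBlock j then c₁ else c₂
pairColoring (suc (suc i)) zero = if evenBlock i then c₃ else c₂
pairColoring (suc (suc i)) (suc zero) = if evenBlock i then c₁ else c₂
pairColoring (suc (suc i)) (suc (suc j)) = pairColoring i j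

pairColoring-sym : ∀ i j → pairColoring i j ≡ pairColoring j i
pairColoring-sym zero zero = refl
pairColoring-sym zero (suc zero) = refl
pairColoring-sym zero (suc (suc j)) = refl
pairColoring-sym (suc zero) zero = refl
pairColoring-sym (suc zero) (suc zero) = refl
pairColoring-sym (suc zero) (suc (suc j)) = refl
pairColoring-sym (suc (suc i)) zero = refl
pairColoring-sym (suc (suc i)) (suc zero) = refl
pairColoring-sym (suc (suc i)) (suc (suc j)) = pairColoring-sym i j

colVal-pairColoring-pair : ∀ i → colVal (pairColoring (2 + i) 0) + colVal (pairColoring (2 + i) 1) ≡ 4
colVal-pairColoring-pair i with evenBlock i
... | true  = refl
... | false = refl

oddColoring : ∀ m → EdgeColoring (odd m) 3
oddColoring m u v = pairColoring (toℕ u) (toℕ v)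

if-not : ∀ {A : Set} b {x y : A} → (if not b then x else y) ≡ (if b then y else x)
if-not true  = refl
if-not false = refl

sumFin-alternating : ∀ m a b → b + sumFin (odd m) (λ w → if evenBlock (toℕ w) then a else b) ≡ suc m * (b + a)
sumFin-alternating zero a b = regroup a b
  where
  regroup : ∀ a b → b + (a + 0) ≡ 1 * (b + a)
  regroup = solve-∀
sumFin-alternating (suc m) a b = begin
  b + sumFin (odd (suc m)) (λ w → if evenBlock (toℕ w) then a else b)
    ≡⟨ cong (b +_) (sumFin-suc (suc (odd m)) (λ w → if evenBlock (toℕ w) then a else b)) ⟩
  b + (a + sumFin (suc (odd m)) (λ w → if evenBlock (suc (toℕ w)) then a else b))
    ≡⟨ cong (λ s → b + (a + s)) (sumFin-suc (odd m) (λ w → if evenBlock (suc (toℕ w)) then a else b)) ⟩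
  b + (a + (a + sumFin (odd m) (λ w → if not (evenBlock (toℕ w)) then a else b)))
    ≡⟨ cong (λ s → b + (a + (a + s))) (sumFin-cong (odd m) (λ w → if-not (evenBlock (toℕ w)))) ⟩
  b + (a + (a + sumFin (odd m) (λ w → if evenBlock (toℕ w) then b else a)))
    ≡⟨ cong (λ s → b + (a + s)) (sumFin-alternating m b a) ⟩
  b + (a + suc m * (a + b))
    ≡⟨ solve (a ∷ b ∷ m ∷ []) ⟩
  suc (suc m) * (b + a) ∎
  where open ≡-Reasoning

colorSum-oddColoring-zero : ∀ m G → colorSum (oddColoring (suc m)) G zero ≡ suc m * (G c₂ + G c₃)
colorSum-oddColoring-zero m G = begin
  colorSum (oddColoring (suc m)) G zero
    ≡⟨ nbrSum-zero (suc (odd m)) (λ u → G (pairColoring 0 (toℕ u))) ⟩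
  sumFin (suc (odd m)) (λ u → G (pairColoring 0 (suc (toℕ u))))
    ≡⟨ sumFin-suc (odd m) (λ u → G (pairColoring 0 (suc (toℕ u)))) ⟩
  G c₂ + sumFin (odd m) (λ w → G (if evenBlock (toℕ w) then c₃ else c₂))
    ≡⟨ cong (G c₂ +_) (sumFin-cong (odd m) (λ w → if-float G (evenBlock (toℕ w)))) ⟩
  G c₂ + sumFin (odd m) (λ w → if evenBlock (toℕ w) then G c₃ else G c₂)
    ≡⟨ sumFin-alternating m (G c₃) (G c₂) ⟩
  suc m * (G c₂ + G c₃) ∎
  where open ≡-Reasoning

colorSum-oddColoring-one : ∀ m G → colorSum (oddColoring (suc m)) G (suc zero) ≡ suc m * (G c₂ + G c₁)
colorSum-oddColoring-one m G = begin
  colorSum (oddColoring (suc m)) G (suc zero)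
    ≡⟨ nbrSum-suc {suc (odd m)} zero (λ u → G (pairColoring 1 (toℕ u))) ⟩
  G c₂ + nbrSum {suc (odd m)} zero (λ u → G (pairColoring 1 (suc (toℕ u))))
    ≡⟨ cong (G c₂ +_) (nbrSum-zero (odd m) (λ u → G (pairColoring 1 (suc (toℕ u))))) ⟩
  G c₂ + sumFin (odd m) (λ w → G (if evenBlock (toℕ w) then c₁ else c₂))
    ≡⟨ cong (G c₂ +_) (sumFin-cong (odd m) (λ w → if-float G (evenBlock (toℕ w)))) ⟩
  G c₂ + sumFin (odd m) (λ w → if evenBlock (toℕ w) then G c₁ else G c₂)
    ≡⟨ sumFin-alternating m (G c₁) (G c₂) ⟩
  suc m * (G c₂ + G c₁) ∎
  where open ≡-Reasoning

colorSum-oddColoring-suc-suc : ∀ m G (w : Fin (odd m)) →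
  colorSum (oddColoring (suc m)) G (suc (suc w))
    ≡ G (pairColoring (2 + toℕ w) 0) + (G (pairColoring (2 + toℕ w) 1) + colorSum (oddColoring m) G w)
colorSum-oddColoring-suc-suc m G w =
  trans (nbrSum-suc (suc w) h) (cong (h zero +_) (nbrSum-suc w (h ∘ suc)))
  where
  h : Fin (odd (suc m)) → ℕ
  h u = G (pairColoring (2 + toℕ w) (toℕ u))

-- rank (2a) = 2m − a and rank (2a + 1) = a.
rank : ∀ m → Fin (odd m) → ℕ
rank zero zero = 0
rank (suc m) zero = 2 + 2 * m
rank (suc m) (suc zero) = 0
rank (suc m) (suc (suc w)) = suc (rank m w)

rank-≤ : ∀ m v → rank m v ≤ 2 * m
rank-≤ zero zero = z≤n
rank-≤ (suc m) zero = ≤-reflexive (sym (*-suc 2 m))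
rank-≤ (suc m) (suc zero) = z≤n
rank-≤ (suc m) (suc (suc w)) = ≤-trans (s≤s (m≤n⇒m≤1+n (rank-≤ m w))) (≤-reflexive (sym (*-suc 2 m)))

rank-injective : ∀ m {u v} → rank m u ≡ rank m v → u ≡ v
rank-injective zero {zero} {zero} _ = refl
rank-injective (suc m) {zero} {zero} _ = refl
rank-injective (suc m) {zero} {suc zero} ()
rank-injective (suc m) {zero} {suc (suc w)} eq = ⊥-elim (<⇒≢ (s≤s (rank-≤ m w)) (sym (suc-injective eq)))
rank-injective (suc m) {suc zero} {zero} ()
rank-injective (suc m) {suc zero} {suc zero} _ = refl
rank-injective (suc m) {suc zero} {suc (suc w)} ()
rank-injective (suc m) {suc (suc w)} {zero} eq = ⊥-elim (<⇒≢ (s≤s (rank-≤ m w)) (suc-injective eq))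
rank-injective (suc m) {suc (suc w)} {suc zero} ()
rank-injective (suc m) {suc (suc u)} {suc (suc v)} eq =
  cong (λ w → suc (suc w)) (rank-injective m (suc-injective eq))

σ-oddColoring : ∀ m v → σ (oddColoring m) v ≡ 3 * m + rank m v
σ-oddColoring zero zero = refl
σ-oddColoring (suc m) zero = trans (colorSum-oddColoring-zero m colVal) (5m+5 m)
  where
  5m+5 : ∀ m → suc m * 5 ≡ 3 * suc m + (2 + 2 * m)
  5m+5 = solve-∀
σ-oddColoring (suc m) (suc zero) = trans (colorSum-oddColoring-one m colVal) (3m+3 m)
  where
  3m+3 : ∀ m → suc m * 3 ≡ 3 * suc m + 0
  3m+3 = solve-∀
σ-oddColoring (suc m) (suc (suc w)) = begin
  σ (oddColoring (suc m)) (suc (suc w))         ≡⟨ colorSum-oddColoring-suc-suc m colVal w ⟩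
  colVal x + (colVal y + σ (oddColoring m) w)   ≡˘⟨ +-assoc (colVal x) (colVal y) _ ⟩
  colVal x + colVal y + σ (oddColoring m) w     ≡⟨ cong₂ _+_ (colVal-pairColoring-pair (toℕ w)) (σ-oddColoring m w) ⟩
  4 + (3 * m + rank m w)                        ≡⟨ regroup m (rank m w) ⟩
  3 * suc m + suc (rank m w)                    ∎
  where
  open ≡-Reasoning
  x = pairColoring (2 + toℕ w) 0
  y = pairColoring (2 + toℕ w) 1
  regroup : ∀ m r → 4 + (3 * m + r) ≡ 3 * suc m + suc r
  regroup = solve-∀

-- If evenBlock i fails, color 2 occurs at most m − 1 times at vertex i of K_{2m+1}; this absorbs
-- the two edges of color 2 that vertex 2 + i of K_{2m+3} gets from the pair {0, 1}.
oddSlack : ℕ → Fin 3 → ℕ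
oddSlack i a = if evenBlock i then 0 else indicator a c₂

indicator-pair+oddSlack≤ : ∀ i a →
  indicator a (pairColoring (2 + i) 0) + indicator a (pairColoring (2 + i) 1) + oddSlack (2 + i) a ≤ suc (oddSlack i a)
indicator-pair+oddSlack≤ i a with evenBlock i
indicator-pair+oddSlack≤ i zero             | true  = ≤-refl
indicator-pair+oddSlack≤ i (suc zero)       | true  = ≤-refl
indicator-pair+oddSlack≤ i (suc (suc zero)) | true  = ≤-refl
indicator-pair+oddSlack≤ i zero             | false = z≤n
indicator-pair+oddSlack≤ i (suc zero)       | false = ≤-refl
indicator-pair+oddSlack≤ i (suc (suc zero)) | false = z≤n

*-indicator-distinct≤ : ∀ m {k} (a : Fin k) {x y} → x ≢ y → m * (indicator a x + indicator a y) ≤ m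
*-indicator-distinct≤ m a x≢y =
  ≤-trans (*-monoʳ-≤ m (indicator-distinct a x≢y)) (≤-reflexive (*-identityʳ m))

colorSum-indicator-oddColoring≤ : ∀ m v a → colorSum (oddColoring m) (indicator a) v + oddSlack (toℕ v) a ≤ m
colorSum-indicator-oddColoring≤ zero zero a = z≤n
colorSum-indicator-oddColoring≤ (suc m) zero a =
  ≤-trans (≤-reflexive (trans (+-identityʳ _) (colorSum-oddColoring-zero m (indicator a))))
          (*-indicator-distinct≤ (suc m) a {c₂} {c₃} (λ ()))
colorSum-indicator-oddColoring≤ (suc m) (suc zero) a =
  ≤-trans (≤-reflexive (trans (+-identityʳ _) (colorSum-oddColoring-one m (indicator a))))
          (*-indicator-distinct≤ (suc m) a {c₂} {c₁} (λ ()))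
colorSum-indicator-oddColoring≤ (suc m) (suc (suc w)) a = begin
  colorSum (oddColoring (suc m)) (indicator a) (suc (suc w)) + oddSlack (2 + i) a
    ≡⟨ cong (_+ oddSlack (2 + i) a) (colorSum-oddColoring-suc-suc m (indicator a) w) ⟩
  p + (q + s) + oddSlack (2 + i) a
    ≡⟨ regroup p q s (oddSlack (2 + i) a) ⟩
  p + q + oddSlack (2 + i) a + s
    ≤⟨ +-monoˡ-≤ s (indicator-pair+oddSlack≤ i a) ⟩
  suc (oddSlack i a + s)
    ≡⟨ cong suc (+-comm (oddSlack i a) s) ⟩
  suc (s + oddSlack i a)
    ≤⟨ s≤s (colorSum-indicator-oddColoring≤ m w a) ⟩
  suc m ∎
  where
  open ≤-Reasoning
  i = toℕ w
  p = indicator a (pairColoring (2 + i) 0)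
  q = indicator a (pairColoring (2 + i) 1)
  s = colorSum (oddColoring m) (indicator a) w
  regroup : ∀ p q s r → p + (q + s) + r ≡ p + q + r + s
  regroup = solve-∀

oddColoring-QMNSD : ∀ m → HasQMNSD (odd m) 3
oddColoring-QMNSD m = oddColoring m , (λ u v _ → pairColoring-sym (toℕ u) (toℕ v)) , qm , nsd
  where
  qm : QM (oddColoring m)
  qm v a = begin
    colorCount (oddColoring m) v a                                ≡⟨ colorCount≡colorSum (oddColoring m) v a ⟩
    colorSum (oddColoring m) (indicator a) v                      ≤⟨ m≤m+n _ _ ⟩
    colorSum (oddColoring m) (indicator a) v + oddSlack (toℕ v) a ≤⟨ colorSum-indicator-oddColoring≤ m v a ⟩
    m                                                             ≡˘⟨ ⌈twice/2⌉ m ⟩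
    ⌈ twice m /2⌉                                                 ≡˘⟨ cong ⌈_/2⌉ (deg-complete v) ⟩
    ⌈ deg v /2⌉                                                   ∎
    where open ≤-Reasoning
  nsd : NSD (oddColoring m)
  nsd u v u≢v σu≡σv = u≢v (rank-injective m (+-cancelˡ-≡ (3 * m) _ _
    (trans (sym (σ-oddColoring m u)) (trans σu≡σv (σ-oddColoring m v)))))

-- Even complete graphs

-- hubColor M r is color 1 for r < M − 1, color 2 for r ∈ {M − 1, M} and color 3 for r > M.
hubColor : ℕ → ℕ → Fin 3
hubColor zero zero = c₂
hubColor zero (suc r) = c₃
hubColor (suc M) (suc r) = hubColor M r
hubColor (suc zero) zero = c₂
hubColor (suc (suc M)) zero = c₁

hubColor-zero≢c₃ : ∀ M → hubColor M 0 ≢ c₃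
hubColor-zero≢c₃ zero ()
hubColor-zero≢c₃ (suc zero) ()
hubColor-zero≢c₃ (suc (suc M)) ()

hubColor-diagonal : ∀ M → hubColor M M ≡ c₂
hubColor-diagonal zero = refl
hubColor-diagonal (suc M) = hubColor-diagonal M

hubColor-above : ∀ M k → hubColor M (suc (M + k)) ≡ c₃
hubColor-above zero k = refl
hubColor-above (suc M) k = hubColor-above M k

hubColor-mono : ∀ M {r s} → r ≤ s → colVal (hubColor M r) ≤ colVal (hubColor M s)
hubColor-mono zero {zero} {zero} _ = ≤-refl
hubColor-mono zero {zero} {suc s} _ = s≤s (s≤s z≤n)
hubColor-mono zero {suc r} {suc s} _ = ≤-refl
hubColor-mono (suc zero) {zero} {zero} _ = ≤-refl
hubColor-mono (suc zero) {zero} {suc s} _ = hubColor-mono zero {zero} {s} z≤n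
hubColor-mono (suc (suc M)) {zero} _ = s≤s z≤n
hubColor-mono (suc M) {suc r} {suc s} (s≤s r≤s) = hubColor-mono M r≤s

evenRank : ℕ → ℕ → ℕ
evenRank M r = r + colVal (hubColor M r)

evenRank-≤ : ∀ M {r s} → r ≤ s → evenRank M r ≤ evenRank M s
evenRank-≤ M r≤s = +-mono-≤ r≤s (hubColor-mono M r≤s)

evenRank-< : ∀ M {r s} → r < s → evenRank M r < evenRank M s
evenRank-< M r<s = +-mono-<-≤ r<s (hubColor-mono M (<⇒≤ r<s))

<-preserving⇒injective : ∀ {f : ℕ → ℕ} → (∀ {r s} → r < s → f r < f s) → ∀ {r s} → f r ≡ f s → r ≡ s
<-preserving⇒injective f-< {r} {s} fr≡fs with <-cmp r s
... | tri< r<s _ _ = ⊥-elim (<⇒≢ (f-< r<s) fr≡fs)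
... | tri≈ _ r≡s _ = r≡s
... | tri> _ _ s<r = ⊥-elim (<⇒≢ (f-< s<r) (sym fr≡fs))

evenRank≢M+3 : ∀ M r → evenRank M r ≢ M + 3
evenRank≢M+3 M r with r ≤? M
... | yes r≤M = <⇒≢ (begin-strict
  evenRank M r               ≤⟨ evenRank-≤ M r≤M ⟩
  M + colVal (hubColor M M)  ≡⟨ cong (λ x → M + colVal x) (hubColor-diagonal M) ⟩
  M + 2                      <⟨ +-monoʳ-< M ≤-refl ⟩
  M + 3                      ∎)
  where open ≤-Reasoning
... | no r≰M = >⇒≢ (begin-strict
  M + 3                      <⟨ n<1+n (M + 3) ⟩
  suc M + 3                  ≡⟨ cong (λ x → suc M + colVal x) (sym hubColor-suc) ⟩
  evenRank M (suc M)         ≤⟨ evenRank-≤ M (≰⇒> r≰M) ⟩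
  evenRank M r               ∎)
  where
  open ≤-Reasoning
  hubColor-suc : hubColor M (suc M) ≡ c₃
  hubColor-suc = subst (λ r → hubColor M (suc r) ≡ c₃) (+-identityʳ M) (hubColor-above M 0)

evenColoring : ∀ M → EdgeColoring (suc (odd M)) 3
evenColoring M zero zero = c₂
evenColoring M zero (suc w) = hubColor M (rank M w)
evenColoring M (suc w) zero = hubColor M (rank M w)
evenColoring M (suc u) (suc v) = oddColoring M u v

evenColoring-sym : ∀ M → Symmetric (evenColoring M)
evenColoring-sym M zero zero _ = refl
evenColoring-sym M zero (suc w) _ = refl
evenColoring-sym M (suc w) zero _ = refl
evenColoring-sym M (suc u) (suc v) _ = pairColoring-sym (toℕ u) (toℕ v)

hubSum : ∀ M → (Fin 3 → ℕ) → ℕ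
hubSum M G = sumFin (odd M) (λ w → G (hubColor M (rank M w)))

hubSum-suc : ∀ M G → hubSum (suc M) G ≡ G c₃ + (G (hubColor (suc M) 0) + hubSum M G)
hubSum-suc M G = begin
  hubSum (suc M) G
    ≡⟨ sumFin-suc (suc (odd M)) h ⟩
  G (hubColor M (suc (M + (M + 0)))) + sumFin (suc (odd M)) (h ∘ suc)
    ≡⟨ cong₂ _+_ (cong G (hubColor-above M (M + 0))) (sumFin-suc (odd M) (h ∘ suc)) ⟩
  G c₃ + (G (hubColor (suc M) 0) + hubSum M G) ∎
  where
  open ≡-Reasoning
  h : Fin (odd (suc M)) → ℕ
  h w = G (hubColor (suc M) (rank (suc M) w))

hubSum-colVal : ∀ M → hubSum (suc M) colVal ≡ 3 * suc M + (suc M + 3)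
hubSum-colVal zero = refl
hubSum-colVal (suc M) = begin
  hubSum (suc (suc M)) colVal             ≡⟨ hubSum-suc (suc M) colVal ⟩
  3 + (1 + hubSum (suc M) colVal)         ≡⟨ cong (λ s → 3 + (1 + s)) (hubSum-colVal M) ⟩
  3 + (1 + (3 * suc M + (suc M + 3)))     ≡⟨ regroup M ⟩
  3 * suc (suc M) + (suc (suc M) + 3)     ∎
  where
  open ≡-Reasoning
  regroup : ∀ M → 3 + (1 + (3 * suc M + (suc M + 3))) ≡ 3 * suc (suc M) + (suc (suc M) + 3)
  regroup = solve-∀

hubSum-indicator≤ : ∀ M a → hubSum M (indicator a) ≤ suc M
hubSum-indicator≤ zero a = ≤-trans (≤-reflexive (+-identityʳ _)) (indicator≤1 a c₂)
hubSum-indicator≤ (suc M) a = begin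
  hubSum (suc M) (indicator a)
    ≡⟨ hubSum-suc M (indicator a) ⟩
  indicator a c₃ + (indicator a (hubColor (suc M) 0) + hubSum M (indicator a))
    ≡˘⟨ +-assoc (indicator a c₃) _ _ ⟩
  indicator a c₃ + indicator a (hubColor (suc M) 0) + hubSum M (indicator a)
    ≤⟨ +-mono-≤ (indicator-distinct a (λ eq → hubColor-zero≢c₃ (suc M) (sym eq))) (hubSum-indicator≤ M a) ⟩
  suc (suc M) ∎
  where open ≤-Reasoning

colorSum-evenColoring-zero : ∀ M G → colorSum (evenColoring M) G zero ≡ hubSum M G
colorSum-evenColoring-zero M G = nbrSum-zero (odd M) (λ u → G (evenColoring M zero u))

colorSum-evenColoring-suc : ∀ M G w →
  colorSum (evenColoring M) G (suc w) ≡ G (hubColor M (rank M w)) + colorSum (oddColoring M) G w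
colorSum-evenColoring-suc M G w = nbrSum-suc w (λ u → G (evenColoring M (suc w) u))

σ-evenColoring-suc : ∀ M w → σ (evenColoring M) (suc w) ≡ 3 * M + evenRank M (rank M w)
σ-evenColoring-suc M w = begin
  σ (evenColoring M) (suc w)                    ≡⟨ colorSum-evenColoring-suc M colVal w ⟩
  colVal (hubColor M r) + σ (oddColoring M) w   ≡⟨ cong (colVal (hubColor M r) +_) (σ-oddColoring M w) ⟩
  colVal (hubColor M r) + (3 * M + r)           ≡⟨ regroup (colVal (hubColor M r)) M r ⟩
  3 * M + (r + colVal (hubColor M r))           ∎
  where
  open ≡-Reasoning
  r = rank M w
  regroup : ∀ x M r → x + (3 * M + r) ≡ 3 * M + (r + x)
  regroup = solve-∀

evenColoring-QMNSD : ∀ M → HasQMNSD (suc (odd (suc M))) 3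
evenColoring-QMNSD M = evenColoring K , evenColoring-sym K , qm , nsd
  where
  K = suc M
  count≤ : ∀ v a → colorSum (evenColoring K) (indicator a) v ≤ suc K
  count≤ zero a =
    ≤-trans (≤-reflexive (colorSum-evenColoring-zero K (indicator a))) (hubSum-indicator≤ K a)
  count≤ (suc w) a =
    ≤-trans (≤-reflexive (colorSum-evenColoring-suc K (indicator a) w))
            (+-mono-≤ (indicator≤1 a (hubColor K (rank K w)))
                      (≤-trans (m≤m+n _ _) (colorSum-indicator-oddColoring≤ K w a)))
  qm : QM (evenColoring K)
  qm v a = begin
    colorCount (evenColoring K) v a           ≡⟨ colorCount≡colorSum (evenColoring K) v a ⟩
    colorSum (evenColoring K) (indicator a) v ≤⟨ count≤ v a ⟩
    suc K                                     ≡˘⟨ ⌈odd/2⌉ K ⟩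
    ⌈ odd K /2⌉                               ≡˘⟨ cong ⌈_/2⌉ (deg-complete v) ⟩
    ⌈ deg v /2⌉                               ∎
    where open ≤-Reasoning
  σ-hub : σ (evenColoring K) zero ≡ 3 * K + (K + 3)
  σ-hub = trans (colorSum-evenColoring-zero K colVal) (hubSum-colVal M)
  hub≢ : ∀ w → σ (evenColoring K) zero ≢ σ (evenColoring K) (suc w)
  hub≢ w eq = evenRank≢M+3 K (rank K w) (sym (+-cancelˡ-≡ (3 * K) _ _
    (trans (sym σ-hub) (trans eq (σ-evenColoring-suc K w)))))
  nsd : NSD (evenColoring K)
  nsd zero zero u≢v _ = u≢v refl
  nsd zero (suc w) _ eq = hub≢ w eq
  nsd (suc w) zero _ eq = hub≢ w (sym eq)
  nsd (suc u) (suc v) u≢v eq = u≢v (cong suc (rank-injective K (<-preserving⇒injective (evenRank-< K)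
    (+-cancelˡ-≡ (3 * K) _ _ (trans (sym (σ-evenColoring-suc K u)) (trans eq (σ-evenColoring-suc K v)))))))

three-colors-suffice : ∀ n → HasQMNSD (3 + n) 3
three-colors-suffice n with parity n
... | inj₁ (m , refl) = oddColoring-QMNSD (suc m)
... | inj₂ (m , refl) = evenColoring-QMNSD m

mainTheorem4 : (n : ℕ) → n ≥ 3 → χqmΣ-K≡ n 3
mainTheorem4 (suc (suc (suc n))) _ = three-colors-suffice n , fewer-colors-insufficient n
mainTheorem4 (suc zero) (s≤s ())
mainTheorem4 (suc (suc zero)) (s≤s (s≤s ()))
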